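{- Let $G$ be a finite group, $H$ a connected directed graph with a rotation system, $\psi$ a local $G$-tension on $H$, and $v$ a fixed vertex of $H$. Then the covering $\ell: H_\psi \to H$, $(u,h)\mapsto u$, $(e,h)\mapsto e$ (with $H_\psi$ as defined below) is a minimal global covering with respect to $\psi$.
   Context: Graphs may have multiple edges and loops. Rotation system: a cyclic order of edge-ends at each vertex (a loop contributes two). Faces: closed walks obtained by face tracing (after entering $w$ along an edge, leave along the next edge-end in the cyclic order at $w$). For a walk $W=(e_1,\dots,e_n)$ and $\phi$ a map on edges to $G$, $h_\phi(W)=\prod_i \phi(e_i)^{\sigma_W(e_i)}$ with $\sigma_W(e_i)=+1$ if $e_i$ is traversed in its direction and $-1$ otherwise. Local $G$-tension: height $1$ on every facial walk; global $G$-tension: height $1$ on every closed walk. A covering $s: K\to H$ (with $K$ a connected directed graph with rotation system) is a surjective graph homomorphism preserving edge directions that at each vertex $x$ restricts to a bijection from edge-ends at $x$ to edge-ends at $s(x)$ respecting cyclic orders; $\psi_s := \psi\circ s$. A covering $s$ is a global covering with respect to $\psi$ if $\psi_s$ is a global $G$-tension on $K$. A global covering $p: K \to H$ with respect to $\psi$ is minimal if for every global covering $r: K' \to H$ with respect to $\psi$ (with $K'$ connected) there is a covering $q: K' \to K$ with $p\circ q = r$. The graph $H_\psi$: vertices are pairs $(e(W),h_\psi(W))$ for walks $W$ in $H$ starting at $v$ ($e(W)$ the end vertex); for each such vertex $(a,h)$ and each edge $e$ of $H$ directed from $a$ to $b$, an edge $(e,h)$ from $(a,h)$ to $(b,h\psi(e))$;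 it carries the rotation system lifted from $H$. -}

module Defs where

open import Data.Nat using (ℕ; zero; suc; _<_)
open import Data.Fin using (Fin)
open import Data.Bool using (Bool; true; false; not)
open import Data.Product using (Σ; ∃; _×_; _,_; proj₁; proj₂)
open import Data.List using (List; []; _∷_; _++_; [_])
open import Relation.Binary.PropositionalEquality using (_≡_; refl; sym; trans; cong; subst)
open import Relation.Nullary using (¬_)
open import Function.Bundles using (_↔_)
open import Algebra.Structures using (IsGroup)

Finite : Set → Set
Finite A = ∃ λ n → A ↔ Fin n

record FinGroup : Set₁ where
  infixl 7 _∙_
  infix 8 _⁻¹
  field
    Carrier : Set
    _∙_     : Carrier → Carrier → Carrier
    ε       : Carrier
    _⁻¹     : Carrier → Carrier
    isGroup : IsGroup _≡_ _∙_ ε _⁻¹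
    finite  : Finite Carrier

record Graph : Set₁ where
  field
    V   : Set
    E   : Set
    src : E → V
    tgt : E → V

module _ (Γ : Graph) where
  open Graph Γ

  -- An edge-end ("dart"): (e , true) is the end of e at src e
  -- (leaving it traverses e in its direction), (e , false) is the end
  -- of e at tgt e (leaving it traverses e against its direction).
  -- A loop thus has two distinct edge-ends.
  Dart : Set
  Dart = E × Bool

  tail : Dart → V
  tail (e , true)  = src e
  tail (e , false) = tgt e

  head : Dart → V
  head (e , true)  = tgt e
  head (e , false) = src e

  flip : Dart → Dart
  flip (e , b) = e , not b

  IsWalk : V → V → List Dart → Set
  IsWalk u w []       = u ≡ w
  IsWalk u w (d ∷ ds) = tail d ≡ u × IsWalk (head d) w ds

  Connected : Set
  Connected = ∀ u w → ∃ λ ds → IsWalk u w ds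

iter : {A : Set} → (A → A) → ℕ → A → A
iter f zero    x = x
iter f (suc k) x = f (iter f k x)

-- Rotation systems: a permutation ρ of the edge-ends preserving the
-- vertex and acting as a single cycle on the edge-ends at each vertex,
-- i.e. a cyclic order of the edge-ends at each vertex (ρ d = next end).

record IsRotationSystem (Γ : Graph) (ρ : Dart Γ → Dart Γ) : Set where
  field
    ρ-vertex   : ∀ d → tail Γ (ρ d) ≡ tail Γ d
    ρ⁻¹        : Dart Γ → Dart Γ
    ρ-inverseˡ : ∀ d → ρ (ρ⁻¹ d) ≡ d
    ρ-inverseʳ : ∀ d → ρ⁻¹ (ρ d) ≡ d
    ρ-cyclic   : ∀ d d' → tail Γ d ≡ tail Γ d' → ∃ λ k → iter ρ k d ≡ d'

record RGraph : Set₁ where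
  field
    graph : Graph
    rot   : Dart graph → Dart graph
    isRot : IsRotationSystem graph rot
  open Graph graph public

open RGraph public using (graph; rot; V; E; src; tgt)

-- face tracing: after entering w along the edge of d, leave along the
-- next edge-end at w in the cyclic order
faceStep : (Γ : RGraph) → Dart (graph Γ) → Dart (graph Γ)
faceStep Γ d = rot Γ (flip (graph Γ) d)

faceWalk : (Γ : RGraph) → ℕ → Dart (graph Γ) → List (Dart (graph Γ))
faceWalk Γ zero    d = []
faceWalk Γ (suc k) d = d ∷ faceWalk Γ k (faceStep Γ d)

module _ (𝔾 : FinGroup) (Γ : Graph) (ψ : Graph.E Γ → FinGroup.Carrier 𝔾) where
  open FinGroup 𝔾

  dartVal : Dart Γ → Carrier
  dartVal (e , true)  = ψ e
  dartVal (e , false) = ψ e ⁻¹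

  heightFrom : Carrier → List (Dart Γ) → Carrier
  heightFrom acc []       = acc
  heightFrom acc (d ∷ ds) = heightFrom (acc ∙ dartVal d) ds

  height : List (Dart Γ) → Carrier
  height = heightFrom ε

  GlobalTension : Set
  GlobalTension = ∀ u ds → IsWalk Γ u u ds → height ds ≡ ε

-- height 1 on every facial walk (a face traced from any of its
-- edge-ends d, of length its period k)
LocalTension : (𝔾 : FinGroup) (Γ : RGraph) → (E Γ → FinGroup.Carrier 𝔾) → Set
LocalTension 𝔾 Γ ψ =
  ∀ d k → 0 < k → iter (faceStep Γ) k d ≡ d →
  (∀ j → 0 < j → j < k → ¬ (iter (faceStep Γ) j d ≡ d)) →
  height 𝔾 (graph Γ) ψ (faceWalk Γ k d) ≡ FinGroup.ε 𝔾

mapDart : (K H : Graph) → (Graph.E K → Graph.E H) → Dart K → Dart H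
mapDart K H sE (e , b) = sE e , b

record IsCovering (K H : RGraph) (sV : V K → V H) (sE : E K → E H) : Set where
  field
    connected  : Connected (graph K)
    surjV      : ∀ y → ∃ λ x → sV x ≡ y
    surjE      : ∀ f → ∃ λ e → sE e ≡ f
    src-pres   : ∀ e → src H (sE e) ≡ sV (src K e)
    tgt-pres   : ∀ e → tgt H (sE e) ≡ sV (tgt K e)
    local-inj  : ∀ d₁ d₂ → tail (graph K) d₁ ≡ tail (graph K) d₂ →
                 mapDart (graph K) (graph H) sE d₁ ≡ mapDart (graph K) (graph H) sE d₂ →
                 d₁ ≡ d₂
    local-surj : ∀ x d' → tail (graph H) d' ≡ sV x →
                 ∃ λ d → tail (graph K) d ≡ x × mapDart (graph K) (graph H) sE d ≡ d'
    rot-pres   : ∀ d → mapDart (graph K) (graph H) sE (rot K d)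
                       ≡ rot H (mapDart (graph K) (graph H) sE d)

IsGlobalCovering : (𝔾 : FinGroup) (K H : RGraph) (ψ : E H → FinGroup.Carrier 𝔾)
                   (sV : V K → V H) (sE : E K → E H) → Set
IsGlobalCovering 𝔾 K H ψ sV sE =
  IsCovering K H sV sE × GlobalTension 𝔾 (graph K) (λ e → ψ (sE e))

IsMinimalGlobalCovering : (𝔾 : FinGroup) (K H : RGraph) (ψ : E H → FinGroup.Carrier 𝔾)
                          (pV : V K → V H) (pE : E K → E H) → Set₁
IsMinimalGlobalCovering 𝔾 K H ψ pV pE =
  IsGlobalCovering 𝔾 K H ψ pV pE ×
  ((K' : RGraph) (rV : V K' → V H) (rE : E K' → E H) →
   IsGlobalCovering 𝔾 K' H ψ rV rE →
   ∃ λ (qV : V K' → V K) → ∃ λ (qE : E K' → E K) →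
     IsCovering K' K qV qE ×
     (∀ x → pV (qV x) ≡ rV x) × (∀ e → pE (qE e) ≡ rE e))

record Sub (A : Set) (P : A → Set) : Set where
  constructor _⟨_⟩
  field
    val     : A
    .reach  : P val
open Sub public

module _ (𝔾 : FinGroup) (H : RGraph) (ψ : E H → FinGroup.Carrier 𝔾) (v : V H) where
  open FinGroup 𝔾
  private
    Γ = graph H

  Reach : V H × Carrier → Set
  Reach (a , h) = ∃ λ ds → IsWalk Γ v a ds × height 𝔾 Γ ψ ds ≡ h

  private
    walk-snoc : ∀ u ds d → IsWalk Γ u (tail Γ d) ds → IsWalk Γ u (head Γ d) (ds ++ [ d ])
    walk-snoc u []        d p       = sym p , refl
    walk-snoc u (d' ∷ ds) d (q , w) = q , walk-snoc (head Γ d') ds d w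

    height-snoc : ∀ acc ds d →
      heightFrom 𝔾 Γ ψ acc (ds ++ [ d ]) ≡ heightFrom 𝔾 Γ ψ acc ds ∙ dartVal 𝔾 Γ ψ d
    height-snoc acc []       d = refl
    height-snoc acc (x ∷ ds) d = height-snoc (acc ∙ dartVal 𝔾 Γ ψ x) ds d

  reach-step : ∀ d {h} → Reach (tail Γ d , h) → Reach (head Γ d , h ∙ dartVal 𝔾 Γ ψ d)
  reach-step d {h} (ds , w , eq) =
    ds ++ [ d ] , walk-snoc v ds d w ,
    trans (height-snoc ε ds d) (cong (_∙ dartVal 𝔾 Γ ψ d) eq)

  HψV : Set
  HψV = Sub (V H × Carrier) Reach

  HψE : Set
  HψE = Sub (E H × Carrier) (λ { (e , h) → Reach (src H e , h) })

  Hψsrc : HψE → HψV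
  Hψsrc ((e , h) ⟨ p ⟩) = (src H e , h) ⟨ p ⟩

  Hψtgt : HψE → HψV
  Hψtgt ((e , h) ⟨ p ⟩) = (tgt H e , h ∙ ψ e) ⟨ reach-step (e , true) p ⟩

  HψGraph : Graph
  HψGraph = record { V = HψV ; E = HψE ; src = Hψsrc ; tgt = Hψtgt }

  private
    groupAt : E H → Carrier → Bool → Carrier
    groupAt e h true  = h
    groupAt e h false = h ∙ ψ e

    dartReach : (e : E H) (h : Carrier) (b : Bool) → Reach (src H e , h) →
                Reach (tail Γ (e , b) , groupAt e h b)
    dartReach e h true  p = p
    dartReach e h false p = reach-step (e , true) p

    liftDart : (d₂ : Dart Γ) (g : Carrier) → .(Reach (tail Γ d₂ , g)) → Dart HψGraph
    liftDart (e₂ , true)  g r = ((e₂ , g) ⟨ r ⟩) , true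
    liftDart (e₂ , false) g r = ((e₂ , g ∙ ψ e₂ ⁻¹) ⟨ reach-step (e₂ , false) r ⟩) , false

  Hψrot : Dart HψGraph → Dart HψGraph
  Hψrot (((e , h) ⟨ p ⟩) , b) =
    liftDart (rot H (e , b)) (groupAt e h b)
      (subst (λ a → Reach (a , groupAt e h b))
             (sym (IsRotationSystem.ρ-vertex (RGraph.isRot H) (e , b)))
             (dartReach e h b p))

  ℓV : HψV → V H
  ℓV x = proj₁ (val x)

  ℓE : HψE → E H
  ℓE x = proj₁ (val x)

  HψRGraph : IsRotationSystem HψGraph Hψrot → RGraph
  HψRGraph isR = record { graph = HψGraph ; rot = Hψrot ; isRot = isR }

-- The second coordinate of a vertex (a , h) of H_ψ, its level, is the ψ-height of every
-- walk from (v , ε) to it, because crossing an edge (e , h) multiplies the level by ψ e;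
-- hence ψ ∘ ℓ has height ε on closed walks. A dart of H_ψ is determined by its tail and
-- its image in H, which makes the lifted rotation a rotation system and ℓ a covering.
-- For a global covering r : K → H, fix x₀ over v: every walk from x₀ to x has the same
-- height h x, and x ↦ (r x , h x) is a covering K → H_ψ through which r factors.
module Submission where

open import Defs
open import Data.Product using (Σ)
open import Algebra.Structures using (IsGroup)

open import Algebra.Bundles using (Group)
import Algebra.Properties.Group as GroupProperties
open import Data.Bool using (true; false)
open import Data.Fin using (Fin; toℕ; combine)
open import Data.Fin.Properties using (any?; pigeonhole; combine-injective; inj⇒≟; toℕ<n)
open import Data.List using (List; []; _∷_; _++_; [_]; map; length; take; drop)
open import Data.List.Properties using (take++drop≡id; length-drop)
open import Data.Nat using (ℕ; zero; suc; _≤_; _<_; _*_; z≤n; s≤s)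
open import Data.Nat.Properties using (≤-refl; ≤-pred; <-≤-trans; ≰⇒>; m≤n⇒m≤1+n; m∸n≤m; _≤?_)
open import Data.Product using (∃; _×_; _,_; proj₁; proj₂)
open import Data.Sum using (_⊎_; inj₁; inj₂)
open import Function.Bundles using (Inverse; Injection; _↣_)
open import Function.Properties.Inverse using (↔⇒↣)
open import Relation.Binary.Definitions using (DecidableEquality)
open import Relation.Binary.PropositionalEquality
  using (_≡_; refl; sym; trans; cong; cong₂; subst; module ≡-Reasoning)
open import Relation.Nullary using (Dec; yes; no; contradiction)
open import Relation.Nullary.Decidable using (_×-dec_; _⊎-dec_; map′; recompute)
open import Relation.Unary using (Decidable)

iter-natural : {A B : Set} (f : A → B) {g : A → A} {h : B → B} →
               (∀ x → f (g x) ≡ h (f x)) → ∀ k x → f (iter g k x) ≡ iter h k (f x)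
iter-natural f comm zero    x = refl
iter-natural f {h = h} comm (suc k) x = trans (comm _) (cong h (iter-natural f comm k x))

iter-invariant : {A B : Set} (f : A → B) {g : A → A} →
                 (∀ x → f (g x) ≡ f x) → ∀ k x → f (iter g k x) ≡ f x
iter-invariant f inv zero    x = refl
iter-invariant f inv (suc k) x = trans (inv _) (iter-invariant f inv k x)

length-take++drop< : {A : Set} {i j : ℕ} (xs : List A) →
                     i < j → j ≤ length xs → length (take i xs ++ drop j xs) < length xs
length-take++drop< {i = zero} {suc j} (x ∷ xs) _ _ =
  s≤s (subst (_≤ length xs) (sym (length-drop j xs)) (m∸n≤m (length xs) j))
length-take++drop< {i = suc i} {suc j} (x ∷ xs) (s≤s i<j) (s≤s j≤n) =
  s≤s (length-take++drop< xs i<j j≤n)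

module _ {A : Set} (fin : Finite A) where
  private
    ι : A ↣ Fin (proj₁ fin)
    ι = ↔⇒↣ (proj₂ fin)

  finite-≟ : DecidableEquality A
  finite-≟ = inj⇒≟ ι

  finite-any? : {P : A → Set} → Decidable P → Dec (∃ P)
  finite-any? {P} P? = map′ (λ (i , p) → from i , p) (λ (a , p) → to a , subst P (sym (inverseʳ refl)) p)
                            (any? (λ i → P? (from i)))
    where open Inverse (proj₂ fin)

module GroupLaws (𝔾 : FinGroup) where
  open FinGroup 𝔾 public
  open IsGroup isGroup public using (assoc; identityˡ; identityʳ)

  group : Group _ _
  group = record { isGroup = isGroup }

  open GroupProperties group public
    using (ε⁻¹≈ε; ⁻¹-involutive; ⁻¹-anti-homo-∙; x∙y⁻¹≈ε⇒x≈y; identityʳ-unique; ∙-cancelʳ;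
           //-rightDividesˡ; //-rightDividesʳ)

module Walks (Γ : Graph) where

  endpoint : Graph.V Γ → List (Dart Γ) → Graph.V Γ
  endpoint u []       = u
  endpoint u (d ∷ ds) = endpoint (head Γ d) ds

  IsWalk-++ : ∀ {u m w} xs {ys} → IsWalk Γ u m xs → IsWalk Γ m w ys → IsWalk Γ u w (xs ++ ys)
  IsWalk-++ []       refl    q = q
  IsWalk-++ (d ∷ xs) (t , p) q = t , IsWalk-++ xs p q

  IsWalk-++⁻ : ∀ {u w} xs {ys} → IsWalk Γ u w (xs ++ ys) →
               IsWalk Γ u (endpoint u xs) xs × IsWalk Γ (endpoint u xs) w ys
  IsWalk-++⁻ []       p       = refl , p
  IsWalk-++⁻ (d ∷ xs) (t , p) = let (p₁ , p₂) = IsWalk-++⁻ xs p in (t , p₁) , p₂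

  IsWalk-splitAt : ∀ {u w} n ds → IsWalk Γ u w ds →
                   IsWalk Γ u (endpoint u (take n ds)) (take n ds) ×
                   IsWalk Γ (endpoint u (take n ds)) w (drop n ds)
  IsWalk-splitAt {u} {w} n ds p =
    IsWalk-++⁻ (take n ds) (subst (IsWalk Γ u w) (sym (take++drop≡id n ds)) p)

  IsWalk-cut : ∀ {u w} i j ds → IsWalk Γ u w ds → endpoint u (take i ds) ≡ endpoint u (take j ds) →
               IsWalk Γ u w (take i ds ++ drop j ds)
  IsWalk-cut {w = w} i j ds p same =
    IsWalk-++ (take i ds) (proj₁ (IsWalk-splitAt i ds p))
      (subst (λ m → IsWalk Γ m w (drop j ds)) (sym same) (proj₂ (IsWalk-splitAt j ds p)))

  reverseWalk : List (Dart Γ) → List (Dart Γ)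
  reverseWalk []       = []
  reverseWalk (d ∷ ds) = reverseWalk ds ++ [ flip Γ d ]

  IsWalk-reverse : ∀ {u w} ds → IsWalk Γ u w ds → IsWalk Γ w u (reverseWalk ds)
  IsWalk-reverse []                  p          = sym p
  IsWalk-reverse ((e , true)  ∷ ds) (refl , p) = IsWalk-++ (reverseWalk ds) (IsWalk-reverse ds p) (refl , refl)
  IsWalk-reverse ((e , false) ∷ ds) (refl , p) = IsWalk-++ (reverseWalk ds) (IsWalk-reverse ds p) (refl , refl)

module Heights (𝔾 : FinGroup) (Γ : Graph) (ψ : Graph.E Γ → FinGroup.Carrier 𝔾) where
  open GroupLaws 𝔾
  open Walks Γ
  open ≡-Reasoning

  private
    h[_] : Dart Γ → Carrier
    h[_] = dartVal 𝔾 Γ ψ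

    heightFrom′ : Carrier → List (Dart Γ) → Carrier
    heightFrom′ = heightFrom 𝔾 Γ ψ

    height′ : List (Dart Γ) → Carrier
    height′ = height 𝔾 Γ ψ

  heightFrom-∙ : ∀ a b ds → heightFrom′ (a ∙ b) ds ≡ a ∙ heightFrom′ b ds
  heightFrom-∙ a b []       = refl
  heightFrom-∙ a b (d ∷ ds) = trans (cong (λ c → heightFrom′ c ds) (assoc a b h[ d ]))
                                    (heightFrom-∙ a (b ∙ h[ d ]) ds)

  heightFrom≡∙height : ∀ a ds → heightFrom′ a ds ≡ a ∙ height′ ds
  heightFrom≡∙height a ds = trans (cong (λ c → heightFrom′ c ds) (sym (identityʳ a))) (heightFrom-∙ a ε ds)

  height-++ : ∀ xs ys → height′ (xs ++ ys) ≡ height′ xs ∙ height′ ys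
  height-++ xs ys = trans (heightFrom-++ ε xs) (heightFrom≡∙height (height′ xs) ys)
    where
    heightFrom-++ : ∀ a xs → heightFrom′ a (xs ++ ys) ≡ heightFrom′ (heightFrom′ a xs) ys
    heightFrom-++ a []       = refl
    heightFrom-++ a (d ∷ xs) = heightFrom-++ (a ∙ h[ d ]) xs

  height-∷ : ∀ d ds → height′ (d ∷ ds) ≡ h[ d ] ∙ height′ ds
  height-∷ d ds = trans (heightFrom≡∙height (ε ∙ h[ d ]) ds) (cong (_∙ height′ ds) (identityˡ h[ d ]))

  height-splitAt : ∀ n ds → height′ ds ≡ height′ (take n ds) ∙ height′ (drop n ds)
  height-splitAt n ds = trans (cong height′ (sym (take++drop≡id n ds))) (height-++ (take n ds) (drop n ds))

  height-cut : ∀ i j ds → height′ (take i ds) ≡ height′ (take j ds) →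
               height′ (take i ds ++ drop j ds) ≡ height′ ds
  height-cut i j ds same = begin
    height′ (take i ds ++ drop j ds)           ≡⟨ height-++ (take i ds) (drop j ds) ⟩
    height′ (take i ds) ∙ height′ (drop j ds)  ≡⟨ cong (_∙ height′ (drop j ds)) same ⟩
    height′ (take j ds) ∙ height′ (drop j ds)  ≡⟨ height-splitAt j ds ⟨
    height′ ds                                 ∎

  heightFrom-map : ∀ {K : Graph} (sE : Graph.E K → Graph.E Γ) g ds →
                   heightFrom′ g (map (mapDart K Γ sE) ds) ≡ heightFrom 𝔾 K (λ e → ψ (sE e)) g ds
  heightFrom-map sE g []                 = refl
  heightFrom-map sE g ((e , true)  ∷ ds) = heightFrom-map sE (g ∙ ψ (sE e)) ds
  heightFrom-map sE g ((e , false) ∷ ds) = heightFrom-map sE (g ∙ ψ (sE e) ⁻¹) ds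

  dartVal-flip : ∀ d → h[ flip Γ d ] ≡ h[ d ] ⁻¹
  dartVal-flip (e , true)  = refl
  dartVal-flip (e , false) = sym (⁻¹-involutive (ψ e))

  height-reverse : ∀ ds → height′ (reverseWalk ds) ≡ height′ ds ⁻¹
  height-reverse []       = sym ε⁻¹≈ε
  height-reverse (d ∷ ds) = begin
    height′ (reverseWalk ds ++ [ flip Γ d ])  ≡⟨ height-++ (reverseWalk ds) [ flip Γ d ] ⟩
    height′ (reverseWalk ds) ∙ (ε ∙ h[ flip Γ d ])
      ≡⟨ cong₂ _∙_ (height-reverse ds) (trans (identityˡ _) (dartVal-flip d)) ⟩
    height′ ds ⁻¹ ∙ h[ d ] ⁻¹                 ≡⟨ ⁻¹-anti-homo-∙ h[ d ] (height′ ds) ⟨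
    (h[ d ] ∙ height′ ds) ⁻¹                  ≡⟨ cong _⁻¹ (height-∷ d ds) ⟨
    height′ (d ∷ ds) ⁻¹                       ∎

  GlobalTension⇒height-unique : GlobalTension 𝔾 Γ ψ → ∀ {u w} xs ys →
                                IsWalk Γ u w xs → IsWalk Γ u w ys → height′ xs ≡ height′ ys
  GlobalTension⇒height-unique global {u} xs ys p q = x∙y⁻¹≈ε⇒x≈y (height′ xs) (height′ ys) (begin
    height′ xs ∙ height′ ys ⁻¹              ≡⟨ cong (height′ xs ∙_) (height-reverse ys) ⟨
    height′ xs ∙ height′ (reverseWalk ys)   ≡⟨ height-++ xs (reverseWalk ys) ⟨
    height′ (xs ++ reverseWalk ys)          ≡⟨ global u _ (IsWalk-++ xs p (IsWalk-reverse ys q)) ⟩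
    ε                                       ∎)

module GraphMorphism (K H : Graph)
  (sV : Graph.V K → Graph.V H) (sE : Graph.E K → Graph.E H)
  (src-pres : ∀ e → Graph.src H (sE e) ≡ sV (Graph.src K e))
  (tgt-pres : ∀ e → Graph.tgt H (sE e) ≡ sV (Graph.tgt K e)) where

  sD : Dart K → Dart H
  sD = mapDart K H sE

  tail-map : ∀ d → tail H (sD d) ≡ sV (tail K d)
  tail-map (e , true)  = src-pres e
  tail-map (e , false) = tgt-pres e

  head-map : ∀ d → head H (sD d) ≡ sV (head K d)
  head-map (e , true)  = tgt-pres e
  head-map (e , false) = src-pres e

  IsWalk-map : ∀ {u w} ds → IsWalk K u w ds → IsWalk H (sV u) (sV w) (map sD ds)
  IsWalk-map []       p       = cong sV p
  IsWalk-map (d ∷ ds) (t , p) =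
    trans (tail-map d) (cong sV t) ,
    subst (λ z → IsWalk H z _ (map sD ds)) (sym (head-map d)) (IsWalk-map ds p)

  module WalkLifting
    (local-surj : ∀ x d → tail H d ≡ sV x → ∃ λ d̃ → tail K d̃ ≡ x × sD d̃ ≡ d) where

    liftWalk : ∀ x {w} ds → IsWalk H (sV x) w ds →
               ∃ λ d̃s → ∃ λ x' → IsWalk K x x' d̃s × sV x' ≡ w × map sD d̃s ≡ ds
    liftWalk x []       p       = [] , x , refl , p , refl
    liftWalk x (d ∷ ds) (t , p) with local-surj x d t
    ... | d̃ , t̃ , refl with liftWalk (head K d̃) ds (subst (λ z → IsWalk H z _ ds) (head-map d̃) p)
    ...   | d̃s , x' , p̃ , e , m = d̃ ∷ d̃s , x' , (t̃ , p̃) , e , cong (sD d̃ ∷_) m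

module WalkSearch (𝔾 : FinGroup) (Γ : Graph) (ψ : Graph.E Γ → FinGroup.Carrier 𝔾)
  (finV : Finite (Graph.V Γ)) (finE : Finite (Graph.E Γ)) where
  open GroupLaws 𝔾
  open Walks Γ
  open Heights 𝔾 Γ ψ

  private
    Vertex : Set
    Vertex = Graph.V Γ

    _≟V_ : DecidableEquality Vertex
    _≟V_ = finite-≟ finV

    _≟G_ : DecidableEquality Carrier
    _≟G_ = finite-≟ finite

  WalkOfHeight : Vertex → Vertex → Carrier → Set
  WalkOfHeight u a h = ∃ λ ds → IsWalk Γ u a ds × height 𝔾 Γ ψ ds ≡ h

  ShortWalkFrom : ℕ → Vertex → Carrier → Vertex → Carrier → Set
  ShortWalkFrom k u g a h =
    ∃ λ ds → length ds ≤ k × IsWalk Γ u a ds × heightFrom 𝔾 Γ ψ g ds ≡ h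

  any-dart? : {P : Dart Γ → Set} → Decidable P → Dec (∃ P)
  any-dart? {P} P? = map′ fromEdge toEdge (finite-any? finE (λ e → P? (e , true) ⊎-dec P? (e , false)))
    where
    fromEdge : (∃ λ e → P (e , true) ⊎ P (e , false)) → ∃ P
    fromEdge (e , inj₁ p) = (e , true) , p
    fromEdge (e , inj₂ p) = (e , false) , p
    toEdge : ∃ P → ∃ λ e → P (e , true) ⊎ P (e , false)
    toEdge ((e , true)  , p) = e , inj₁ p
    toEdge ((e , false) , p) = e , inj₂ p

  short-walk? : ∀ k u g a h → Dec (ShortWalkFrom k u g a h)
  short-walk? k u g a h with u ≟V a ×-dec g ≟G h
  ... | yes (u≡a , g≡h) = yes ([] , z≤n , u≡a , g≡h)
  short-walk? zero u g a h | no ¬empty =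
    no λ { ([] , _ , p , e) → ¬empty (p , e) ; (_ ∷ _ , () , _) }
  short-walk? (suc k) u g a h | no ¬empty
    with any-dart? (λ d → tail Γ d ≟V u ×-dec short-walk? k (head Γ d) (g ∙ dartVal 𝔾 Γ ψ d) a h)
  ... | yes (d , t , ds , l , p , e) = yes (d ∷ ds , s≤s l , (t , p) , e)
  ... | no ¬step = no λ { ([] , _ , p , e) → ¬empty (p , e)
                        ; (d ∷ ds , s≤s l , (t , p) , e) → ¬step (d , t , ds , l , p , e) }

  stateBound : ℕ
  stateBound = proj₁ finV * proj₁ finite

  private
    ιV : Vertex ↣ Fin (proj₁ finV)
    ιV = ↔⇒↣ (proj₂ finV)

    ιG : Carrier ↣ Fin (proj₁ finite)
    ιG = ↔⇒↣ (proj₂ finite)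

    state : Vertex → List (Dart Γ) → Fin stateBound
    state u xs = combine (Injection.to ιV (endpoint u xs)) (Injection.to ιG (height 𝔾 Γ ψ xs))

  -- Among the prefixes of a walk longer than stateBound, two end at the same
  -- vertex with the same height (pigeonhole); the part between them is cut out.
  shortcut : ∀ {u a} ds → stateBound < length ds → IsWalk Γ u a ds →
             ∃ λ ds' → length ds' < length ds × IsWalk Γ u a ds' × height 𝔾 Γ ψ ds' ≡ height 𝔾 Γ ψ ds
  shortcut {u} ds long p with pigeonhole (m≤n⇒m≤1+n long) (λ i → state u (take (toℕ i) ds))
  ... | i , j , i<j , same with combine-injective _ _ _ _ same
  ... | sameV , sameG =
    take (toℕ i) ds ++ drop (toℕ j) ds ,
    length-take++drop< ds i<j (≤-pred (toℕ<n j)) ,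
    IsWalk-cut (toℕ i) (toℕ j) ds p (Injection.injective ιV sameV) ,
    height-cut (toℕ i) (toℕ j) ds (Injection.injective ιG sameG)

  walk⇒short-walk : ∀ n {u a} ds → length ds ≤ n → IsWalk Γ u a ds →
                    ShortWalkFrom stateBound u ε a (height 𝔾 Γ ψ ds)
  walk⇒short-walk n ds l p with length ds ≤? stateBound
  ... | yes short = ds , short , p , refl
  walk⇒short-walk (suc n) ds l p | no long with shortcut ds (≰⇒> long) p
  ... | ds' , shorter , p' , e =
    subst (ShortWalkFrom stateBound _ ε _) e (walk⇒short-walk n ds' (≤-pred (<-≤-trans shorter l)) p')
  walk⇒short-walk zero    []      _  _ | no long = contradiction z≤n long
  walk⇒short-walk zero    (_ ∷ _) () _ | no _

  walkOfHeight? : ∀ u a h → Dec (WalkOfHeight u a h)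
  walkOfHeight? u a h =
    map′ (λ (ds , _ , p , e) → ds , p , e)
         (λ (ds , p , e) → subst (ShortWalkFrom stateBound u ε a) e (walk⇒short-walk (length ds) ds ≤-refl p))
         (short-walk? stateBound u ε a h)

module LiftedGraph (𝔾 : FinGroup) (H : RGraph) (ψ : E H → FinGroup.Carrier 𝔾) (v : V H) where
  open GroupLaws 𝔾

  private
    Γ : Graph
    Γ = graph H

    Hψ : Graph
    Hψ = HψGraph 𝔾 H ψ v

    ψℓ : HψE 𝔾 H ψ v → Carrier
    ψℓ e = ψ (ℓE 𝔾 H ψ v e)

    module ρ = IsRotationSystem (RGraph.isRot H)

  open GraphMorphism Hψ Γ (ℓV 𝔾 H ψ v) (ℓE 𝔾 H ψ v) (λ _ → refl) (λ _ → refl) public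
    renaming (sD to ℓD)

  val-injective : ∀ {x y : HψV 𝔾 H ψ v} → val x ≡ val y → x ≡ y
  val-injective {_ ⟨ _ ⟩} {_ ⟨ _ ⟩} refl = refl

  valE-injective : ∀ {x y : HψE 𝔾 H ψ v} → val x ≡ val y → x ≡ y
  valE-injective {_ ⟨ _ ⟩} {_ ⟨ _ ⟩} refl = refl

  level : HψV 𝔾 H ψ v → Carrier
  level x = proj₂ (val x)

  val-head : ∀ D → val (head Hψ D) ≡ (head Γ (ℓD D) , level (tail Hψ D) ∙ dartVal 𝔾 Γ ψ (ℓD D))
  val-head (x , true)  = refl
  val-head (x , false) =
    cong (src H (ℓE 𝔾 H ψ v x) ,_) (sym (//-rightDividesʳ (ψ (ℓE 𝔾 H ψ v x)) (level (Hψsrc 𝔾 H ψ v x))))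

  dart-unique : ∀ D₁ D₂ → tail Hψ D₁ ≡ tail Hψ D₂ → ℓD D₁ ≡ ℓD D₂ → D₁ ≡ D₂
  dart-unique (x₁ , true)  (x₂ , .true)  t refl = cong (_, true) (valE-injective (cong₂ _,_ refl (cong level t)))
  dart-unique (x₁ , false) (x₂ , .false) t refl =
    cong (_, false) (valE-injective (cong₂ _,_ refl (∙-cancelʳ (ψ (ℓE 𝔾 H ψ v x₁)) _ _ (cong level t))))

  liftAt : (x : HψV 𝔾 H ψ v) (d : Dart Γ) → tail Γ d ≡ ℓV 𝔾 H ψ v x → Dart Hψ
  liftAt ((a , g) ⟨ r ⟩) (e , true)  t =
    ((e , g) ⟨ subst (λ z → Reach 𝔾 H ψ v (z , g)) (sym t) r ⟩) , true
  liftAt ((a , g) ⟨ r ⟩) (e , false) t =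
    ((e , g ∙ ψ e ⁻¹) ⟨ reach-step 𝔾 H ψ v (e , false) (subst (λ z → Reach 𝔾 H ψ v (z , g)) (sym t) r) ⟩) ,
    false

  tail-liftAt : ∀ x d t → tail Hψ (liftAt x d t) ≡ x
  tail-liftAt ((a , g) ⟨ r ⟩) (e , true)  t = val-injective (cong (_, g) t)
  tail-liftAt ((a , g) ⟨ r ⟩) (e , false) t = val-injective (cong₂ _,_ t (//-rightDividesˡ (ψ e) g))

  ℓD-liftAt : ∀ x d t → ℓD (liftAt x d t) ≡ d
  ℓD-liftAt x (e , true)  t = refl
  ℓD-liftAt x (e , false) t = refl

  ℓ-local-surj : ∀ x d → tail Γ d ≡ ℓV 𝔾 H ψ v x → ∃ λ D → tail Hψ D ≡ x × ℓD D ≡ d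
  ℓ-local-surj x d t = liftAt x d t , tail-liftAt x d t , ℓD-liftAt x d t

  open WalkLifting ℓ-local-surj public

  private
    rotψ : Dart Hψ → Dart Hψ
    rotψ = Hψrot 𝔾 H ψ v

  ℓD-rot : ∀ D → ℓD (rotψ D) ≡ rot H (ℓD D)
  ℓD-rot (((e , h) ⟨ p ⟩) , b) with rot H (e , b) | ρ.ρ-vertex (e , b)
  ... | (e₂ , true)  | _ = refl
  ... | (e₂ , false) | _ = refl

  tail-rot : ∀ D → tail Hψ (rotψ D) ≡ tail Hψ D
  tail-rot (((e , h) ⟨ p ⟩) , true) with rot H (e , true) | ρ.ρ-vertex (e , true)
  ... | (e₂ , true)  | t = val-injective (cong₂ _,_ t refl)
  ... | (e₂ , false) | t = val-injective (cong₂ _,_ t (//-rightDividesˡ (ψ e₂) h))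
  tail-rot (((e , h) ⟨ p ⟩) , false) with rot H (e , false) | ρ.ρ-vertex (e , false)
  ... | (e₂ , true)  | t = val-injective (cong₂ _,_ t refl)
  ... | (e₂ , false) | t = val-injective (cong₂ _,_ t (//-rightDividesˡ (ψ e₂) (h ∙ ψ e)))

  Hψ-isRotationSystem : IsRotationSystem Hψ rotψ
  Hψ-isRotationSystem = record
    { ρ-vertex   = tail-rot
    ; ρ⁻¹        = rot⁻¹
    ; ρ-inverseˡ = λ D → dart-unique _ D
        (trans (tail-rot (rot⁻¹ D)) (tail-rot⁻¹ D))
        (trans (ℓD-rot (rot⁻¹ D)) (trans (cong (rot H) (ℓD-rot⁻¹ D)) (ρ.ρ-inverseˡ (ℓD D))))
    ; ρ-inverseʳ = λ D → dart-unique _ D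
        (trans (tail-rot⁻¹ (rotψ D)) (tail-rot D))
        (trans (ℓD-rot⁻¹ (rotψ D)) (trans (cong ρ.ρ⁻¹ (ℓD-rot D)) (ρ.ρ-inverseʳ (ℓD D))))
    ; ρ-cyclic   = cyclic
    }
    where
    tail-ρ⁻¹ : ∀ D → tail Γ (ρ.ρ⁻¹ (ℓD D)) ≡ ℓV 𝔾 H ψ v (tail Hψ D)
    tail-ρ⁻¹ D = trans (sym (ρ.ρ-vertex (ρ.ρ⁻¹ (ℓD D))))
                       (trans (cong (tail Γ) (ρ.ρ-inverseˡ (ℓD D))) (tail-map D))

    rot⁻¹ : Dart Hψ → Dart Hψ
    rot⁻¹ D = liftAt (tail Hψ D) (ρ.ρ⁻¹ (ℓD D)) (tail-ρ⁻¹ D)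

    tail-rot⁻¹ : ∀ D → tail Hψ (rot⁻¹ D) ≡ tail Hψ D
    tail-rot⁻¹ D = tail-liftAt (tail Hψ D) (ρ.ρ⁻¹ (ℓD D)) (tail-ρ⁻¹ D)

    ℓD-rot⁻¹ : ∀ D → ℓD (rot⁻¹ D) ≡ ρ.ρ⁻¹ (ℓD D)
    ℓD-rot⁻¹ D = ℓD-liftAt (tail Hψ D) (ρ.ρ⁻¹ (ℓD D)) (tail-ρ⁻¹ D)

    cyclic : ∀ D D' → tail Hψ D ≡ tail Hψ D' → ∃ λ k → iter rotψ k D ≡ D'
    cyclic D D' t
      with ρ.ρ-cyclic (ℓD D) (ℓD D') (trans (tail-map D) (trans (cong (ℓV 𝔾 H ψ v) t) (sym (tail-map D'))))
    ... | k , ρᵏ = k , dart-unique _ D'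
      (trans (iter-invariant (tail Hψ) tail-rot k D) t)
      (trans (iter-natural ℓD ℓD-rot k D) ρᵏ)

  level-walk : ∀ {x y} Ds → IsWalk Hψ x y Ds → level y ≡ heightFrom 𝔾 Hψ ψℓ (level x) Ds
  level-walk []       refl        = refl
  level-walk (D ∷ Ds) (refl , p) =
    trans (level-walk Ds p)
          (cong (λ g → heightFrom 𝔾 Hψ ψℓ g Ds) (trans (cong proj₂ (val-head D)) (dartVal-ℓ D)))
    where
    dartVal-ℓ : ∀ D → level (tail Hψ D) ∙ dartVal 𝔾 Γ ψ (ℓD D)
                    ≡ level (tail Hψ D) ∙ dartVal 𝔾 Hψ ψℓ D
    dartVal-ℓ (_ , true)  = refl
    dartVal-ℓ (_ , false) = refl

  Hψ-globalTension : GlobalTension 𝔾 Hψ ψℓ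
  Hψ-globalTension x Ds p = identityʳ-unique (level x) _
    (sym (trans (level-walk Ds p) (Heights.heightFrom≡∙height 𝔾 Hψ ψℓ (level x) Ds)))

module Universality (𝔾 : FinGroup) (H : RGraph) (finV : Finite (V H)) (finE : Finite (E H))
  (connected : Connected (graph H)) (ψ : E H → FinGroup.Carrier 𝔾) (v : V H) where
  open GroupLaws 𝔾
  open LiftedGraph 𝔾 H ψ v
  open Heights 𝔾 (graph H) ψ using (heightFrom-map)
  open WalkSearch 𝔾 (graph H) ψ finV finE using (walkOfHeight?)

  private
    Γ : Graph
    Γ = graph H

    Hψ : Graph
    Hψ = HψGraph 𝔾 H ψ v

  -- Vertices and edges of H_ψ carry their reachability witness irrelevantly;
  -- finiteness makes reachability decidable, so a witness can be recomputed.
  recomputeReach : ∀ {a h} → .(Reach 𝔾 H ψ v (a , h)) → Reach 𝔾 H ψ v (a , h)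
  recomputeReach {a} {h} = recompute (walkOfHeight? v a h)

  root : HψV 𝔾 H ψ v
  root = (v , ε) ⟨ [] , refl , refl ⟩

  walkFromRoot : ∀ x → ∃ λ Ds → IsWalk Hψ root x Ds
  walkFromRoot ((a , h) ⟨ r ⟩) with recomputeReach r
  ... | ds , p , refl with liftWalk root ds p
  ...   | Ds , y , q , refl , refl =
    Ds , subst (λ z → IsWalk Hψ root z Ds) (val-injective (cong (ℓV 𝔾 H ψ v y ,_) level-y)) q
    where
    level-y : level y ≡ height 𝔾 Γ ψ (map ℓD Ds)
    level-y = trans (level-walk Ds q) (sym (heightFrom-map (ℓE 𝔾 H ψ v) ε Ds))

  Hψ-connected : Connected Hψ
  Hψ-connected x y =
    let (Dx , px) = walkFromRoot x
        (Dy , py) = walkFromRoot y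
    in reverseWalk Dx ++ Dy , IsWalk-++ (reverseWalk Dx) (IsWalk-reverse Dx px) py
    where open Walks Hψ

  ℓ-isCovering : (isR : IsRotationSystem Hψ (Hψrot 𝔾 H ψ v)) →
                 IsCovering (HψRGraph 𝔾 H ψ v isR) H (ℓV 𝔾 H ψ v) (ℓE 𝔾 H ψ v)
  ℓ-isCovering isR = record
    { connected  = Hψ-connected
    ; surjV      = λ a → let (ds , p) = connected v a in
                           ((a , height 𝔾 Γ ψ ds) ⟨ ds , p , refl ⟩) , refl
    ; surjE      = λ e → let (ds , p) = connected v (src H e) in
                           ((e , height 𝔾 Γ ψ ds) ⟨ ds , p , refl ⟩) , refl
    ; src-pres   = λ _ → refl
    ; tgt-pres   = λ _ → refl
    ; local-inj  = dart-unique
    ; local-surj = ℓ-local-surj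
    ; rot-pres   = ℓD-rot
    }

  module Factorisation (isR : IsRotationSystem Hψ (Hψrot 𝔾 H ψ v))
    (K : RGraph) (rV : V K → V H) (rE : E K → E H) (global : IsGlobalCovering 𝔾 K H ψ rV rE) where

    private
      Γ' : Graph
      Γ' = graph K

      ψr : E K → Carrier
      ψr e = ψ (rE e)

      module r = IsCovering (proj₁ global)
      module ρ' = IsRotationSystem (RGraph.isRot K)
      module rMap = GraphMorphism Γ' Γ rV rE r.src-pres r.tgt-pres
      module rLift = rMap.WalkLifting r.local-surj

    x₀ : V K
    x₀ = proj₁ (r.surjV v)

    walkTo : ∀ x → ∃ λ ds → IsWalk Γ' x₀ x ds
    walkTo = r.connected x₀

    -- independent of the chosen walk, as ψ ∘ r is a global tension
    heightAt : V K → Carrier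
    heightAt x = height 𝔾 Γ' ψr (proj₁ (walkTo x))

    heightAt-unique : ∀ {x} ds → IsWalk Γ' x₀ x ds → heightAt x ≡ height 𝔾 Γ' ψr ds
    heightAt-unique {x} ds p =
      Heights.GlobalTension⇒height-unique 𝔾 Γ' ψr (proj₂ global) (proj₁ (walkTo x)) ds (proj₂ (walkTo x)) p

    heightAt-step : ∀ e → heightAt (tgt K e) ≡ heightAt (src K e) ∙ ψ (rE e)
    heightAt-step e with walkTo (src K e)
    ... | ds , p =
      trans (heightAt-unique (ds ++ [ (e , true) ]) (Walks.IsWalk-++ Γ' ds p (refl , refl)))
            (trans (Heights.height-++ 𝔾 Γ' ψr ds [ (e , true) ]) (cong (height 𝔾 Γ' ψr ds ∙_) (identityˡ _)))

    reachAt : ∀ x → Reach 𝔾 H ψ v (rV x , heightAt x)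
    reachAt x with walkTo x
    ... | ds , p = map rMap.sD ds ,
      subst (λ z → IsWalk Γ z (rV x) (map rMap.sD ds)) (proj₂ (r.surjV v)) (rMap.IsWalk-map ds p) ,
      heightFrom-map rE ε ds

    qV : V K → HψV 𝔾 H ψ v
    qV x = (rV x , heightAt x) ⟨ reachAt x ⟩

    qE : E K → HψE 𝔾 H ψ v
    qE e = (rE e , heightAt (src K e))
      ⟨ subst (λ z → Reach 𝔾 H ψ v (z , heightAt (src K e))) (sym (r.src-pres e)) (reachAt (src K e)) ⟩

    qV-surj : ∀ y → ∃ λ x → qV x ≡ y
    qV-surj ((a , h) ⟨ w ⟩) with recomputeReach w
    ... | ds , p , refl
      with rLift.liftWalk x₀ ds (subst (λ z → IsWalk Γ z a ds) (sym (proj₂ (r.surjV v))) p)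
    ...   | ds' , x , p' , refl , refl =
      x , val-injective (cong (rV x ,_) (trans (heightAt-unique ds' p') (sym (heightFrom-map rE ε ds'))))

    private
      qMap-src : ∀ e → Graph.src Hψ (qE e) ≡ qV (src K e)
      qMap-src e = val-injective (cong (_, heightAt (src K e)) (r.src-pres e))

      qMap-tgt : ∀ e → Graph.tgt Hψ (qE e) ≡ qV (tgt K e)
      qMap-tgt e = val-injective (cong₂ _,_ (r.tgt-pres e) (sym (heightAt-step e)))

      module qMap = GraphMorphism Γ' Hψ qV qE qMap-src qMap-tgt

    q-isCovering : IsCovering K (HψRGraph 𝔾 H ψ v isR) qV qE
    q-isCovering = record
      { connected  = r.connected
      ; surjV      = qV-surj
      ; surjE      = qE-surj
      ; src-pres   = qMap-src
      ; tgt-pres   = qMap-tgt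
      ; local-inj  = λ d₁ d₂ t m → r.local-inj d₁ d₂ t (cong ℓD m)
      ; local-surj = q-local-surj
      ; rot-pres   = λ d → dart-unique (qMap.sD (rot K d)) (Hψrot 𝔾 H ψ v (qMap.sD d))
          (trans (qMap.tail-map (rot K d))
            (trans (cong qV (ρ'.ρ-vertex d)) (sym (trans (tail-rot (qMap.sD d)) (qMap.tail-map d)))))
          (trans (r.rot-pres d) (sym (ℓD-rot (qMap.sD d))))
      }
      where
      qE-surj : ∀ f → ∃ λ e → qE e ≡ f
      qE-surj ((e , h) ⟨ w ⟩) with qV-surj ((src H e , h) ⟨ w ⟩)
      ... | x , qx with r.local-surj x (e , true) (cong (ℓV 𝔾 H ψ v) (sym qx))
      ...   | (e' , .true) , t , refl =
        e' , valE-injective (cong (rE e' ,_) (trans (cong heightAt t) (cong level qx)))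

      q-local-surj : ∀ x D → tail Hψ D ≡ qV x → ∃ λ d → tail Γ' d ≡ x × qMap.sD d ≡ D
      q-local-surj x D t with r.local-surj x (ℓD D) (trans (tail-map D) (cong (ℓV 𝔾 H ψ v) t))
      ... | d , td , md = d , td , dart-unique (qMap.sD d) D
        (trans (qMap.tail-map d) (trans (cong qV td) (sym t))) md

proposition4p7 : (𝔾 : FinGroup) (H : RGraph) →
    Finite (V H) → Finite (E H) → Connected (graph H) →
    (ψ : E H → FinGroup.Carrier 𝔾) → LocalTension 𝔾 H ψ →
    (v : V H) →
    Σ (IsRotationSystem (HψGraph 𝔾 H ψ v) (Hψrot 𝔾 H ψ v)) λ isR →
      IsMinimalGlobalCovering 𝔾 (HψRGraph 𝔾 H ψ v isR) H ψ (ℓV 𝔾 H ψ v) (ℓE 𝔾 H ψ v)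
proposition4p7 𝔾 H finV finE connected ψ _ v =
  Hψ-isRotationSystem , (ℓ-isCovering Hψ-isRotationSystem , Hψ-globalTension) ,
  λ K rV rE global → let open Factorisation Hψ-isRotationSystem K rV rE global in
    qV , qE , q-isCovering , (λ _ → refl) , (λ _ → refl)
  where
  open Universality 𝔾 H finV finE connected ψ v
  open LiftedGraph 𝔾 H ψ v using (Hψ-isRotationSystem; Hψ-globalTension)
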